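{- Let $X,Y,Z$ be finite sets, $T\subseteq X\times Y\times Z$, and let $A\subseteq X$, $B\subseteq Y$, $C\subseteq Z$ be independent random subsets such that each element of $X$ is included in $A$ with probability $\alpha$, independently of the other elements, each element of $Y$ is included in $B$ with probability $\beta$, independently, and each element of $Z$ is included in $C$ with probability $\gamma$, independently. Then \[ \Pr[T\cap(A\times B\times C)=\emptyset]\le(1-\alpha)^{\lvert\pi_X(T)\rvert}+(1-\beta)^{\min_{x\in\pi_X(T)}\lvert\pi_Y(T\cap(\{x\}\times Y\times Z))\rvert}+(1-\gamma)^{\min_{(x,y)\in\pi_{XY}(T)}\lvert\pi_Z(T\cap(\{x\}\times\{y\}\times Z))\rvert}, \] where $\pi_X:X\times Y\times Z\to X$, $\pi_Y$, $\pi_Z$ and $\pi_{XY}:X\times Y\times Z\to X\times Y$ are the projection maps.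
   Formalization: The inclusion probabilities α, β and γ are taken over the rationals in [0,1]. -}

module Defs where

open import Data.Bool using (Bool; true; false; _∧_; if_then_else_)
open import Data.Nat using (ℕ; zero; suc; _⊓_)
open import Data.Fin using (Fin)
open import Data.Product using (_×_; _,_; proj₁; proj₂)
open import Data.List using (List; []; _∷_; map; concatMap; foldr; filter; length; allFin)
open import Data.Bool.ListAction using (any; all)
open import Data.Vec using (Vec; []; _∷_; lookup)
open import Data.Rational using (ℚ; 0ℚ; 1ℚ; _+_; _*_; _-_)
open import Relation.Nullary.Decidable using (T?)

_^ℚ_ : ℚ → ℕ → ℚ
q ^ℚ zero  = 1ℚ
q ^ℚ suc n = q * (q ^ℚ n)

sumℚ : List ℚ → ℚ
sumℚ = foldr _+_ 0ℚ

-- A subset of Fin n is its characteristic vector (as Data.Fin.Subset does).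
-- All 2^n subsets of Fin n.
allSubsets : (n : ℕ) → List (Vec Bool n)
allSubsets zero    = [] ∷ []
allSubsets (suc n) = concatMap (λ v → (true ∷ v) ∷ (false ∷ v) ∷ []) (allSubsets n)

weight : {n : ℕ} → ℚ → Vec Bool n → ℚ
weight p []          = 1ℚ
weight p (true ∷ v)  = p * weight p v
weight p (false ∷ v) = (1ℚ - p) * weight p v

Rel3 : ℕ → ℕ → ℕ → Set
Rel3 nx ny nz = Fin nx → Fin ny → Fin nz → Bool

disjointBox : {nx ny nz : ℕ} → Rel3 nx ny nz →
              Vec Bool nx → Vec Bool ny → Vec Bool nz → Bool
disjointBox {nx} {ny} {nz} T A B C =
  all (λ x → all (λ y → all (λ z →
    if T x y z ∧ lookup A x ∧ lookup B y ∧ lookup C z then false else true)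
    (allFin nz)) (allFin ny)) (allFin nx)

probDisjoint : {nx ny nz : ℕ} → Rel3 nx ny nz → ℚ → ℚ → ℚ → ℚ
probDisjoint {nx} {ny} {nz} T α β γ =
  sumℚ (map (λ A → sumℚ (map (λ B → sumℚ (map (λ C →
    if disjointBox T A B C then weight α A * weight β B * weight γ C else 0ℚ)
    (allSubsets nz))) (allSubsets ny))) (allSubsets nx))

-- Minimum of a list of naturals; the empty minimum is 0 (convention; only
-- relevant when π_X(T) = ∅, where the inequality is trivial anyway).
minList : List ℕ → ℕ
minList []       = 0
minList (n ∷ ns) = foldr _⊓_ n ns

projX : {nx ny nz : ℕ} → Rel3 nx ny nz → List (Fin nx)
projX {nx} {ny} {nz} T =
  filter (λ x → T? (any (λ y → any (λ z → T x y z) (allFin nz)) (allFin ny))) (allFin nx)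

fibreYsize : {nx ny nz : ℕ} → Rel3 nx ny nz → Fin nx → ℕ
fibreYsize {nx} {ny} {nz} T x =
  length (filter (λ y → T? (any (λ z → T x y z) (allFin nz))) (allFin ny))

projXY : {nx ny nz : ℕ} → Rel3 nx ny nz → List (Fin nx × Fin ny)
projXY {nx} {ny} {nz} T =
  filter (λ p → T? (any (λ z → T (proj₁ p) (proj₂ p) z) (allFin nz)))
         (concatMap (λ x → map (λ y → (x , y)) (allFin ny)) (allFin nx))


fibreZsize : {nx ny nz : ℕ} → Rel3 nx ny nz → Fin nx → Fin ny → ℕ
fibreZsize {nx} {ny} {nz} T x y = length (filter (λ z → T? (T x y z)) (allFin nz))

{-# OPTIONS --safe #-}

-- Reveal A, B, C one coordinate at a time.  Either A misses π_X(T), which has probability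
-- (1-α)^|π_X(T)|, or A contains some x ∈ π_X(T).  Then either B misses the fibre
-- {y | (x,y) ∈ π_XY(T)}, of probability at most (1-β)^(min fibre size), or B contains such a y,
-- and then C must miss {z | (x,y,z) ∈ T}, of probability at most (1-γ)^(min fibre size).
-- Every stage is the same estimate: if 0 ≤ c, f ≤ 1 everywhere and f ≤ c on every outcome that
-- meets a fixed set s, then 𝔼 f ≤ Pr[the outcome misses s] + c = (1-p)^|s| + c.

module Submission where

open import Defs
open import Data.Nat using (ℕ; zero; suc)
open import Data.List using (map; length)
open import Data.Product using (proj₁; proj₂)
open import Data.Rational using (ℚ; 0ℚ; 1ℚ; _≤_; _+_; _-_)

open import Data.Bool using (Bool; true; false; T; not; _∧_; _∨_; if_then_else_)
open import Data.Bool.ListAction using (any; all)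
open import Data.Bool.Properties using (T-∧)
open import Data.Empty using (⊥-elim)
open import Data.Fin using (Fin; zero; suc)
import Data.Fin as Fin
open import Data.Fin.Properties using (any?)
import Data.Nat as ℕ
import Data.Nat.Properties as ℕ
open import Data.List using (List; []; _∷_; concatMap; filter; allFin; tabulate)
open import Data.List.Properties
  using (map-cong; map-tabulate; length-map; filter-accept; filter-reject; foldr-preservesᵒ)
open import Data.List.Membership.Propositional using (_∈_; lose)
open import Data.List.Membership.Propositional.Properties using (∈-map⁺; ∈-filter⁺; ∈-allFin; ∈-concatMap⁺)
import Data.List.Relation.Unary.All as All
open import Data.List.Relation.Unary.All.Properties using (all⁺)
open import Data.List.Relation.Unary.Any using (Any; here; there)
import Data.List.Relation.Unary.Any as Any
open import Data.Product using (∃; _×_; _,_)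
open import Data.Rational using (_*_; -_; nonNegative)
open import Data.Rational.Properties
open import Data.Rational.Solver using (module +-*-Solver)
open import Data.Sum using (_⊎_; inj₁; inj₂; [_,_])
open import Data.Unit using (tt)
open import Data.Vec using (Vec; []; _∷_; lookup)
open import Function using (_∘_; id)
open import Function.Bundles using (module Equivalence)
open import Relation.Binary.PropositionalEquality
  using (_≡_; refl; sym; trans; cong; cong₂; subst; subst₂; module ≡-Reasoning)
open import Relation.Nullary using (¬_)
open import Relation.Nullary.Decidable using (Dec; yes; no; does; T?; _×-dec_)

open +-*-Solver

sumℚ-map-*ˡ : ∀ {A : Set} (c : ℚ) (f : A → ℚ) (xs : List A) →
              sumℚ (map (λ x → c * f x) xs) ≡ c * sumℚ (map f xs)
sumℚ-map-*ˡ c f []       = sym (*-zeroʳ c)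
sumℚ-map-*ˡ c f (x ∷ xs) = begin
  c * f x + sumℚ (map (λ x → c * f x) xs) ≡⟨ cong (c * f x +_) (sumℚ-map-*ˡ c f xs) ⟩
  c * f x + c * sumℚ (map f xs)           ≡⟨ *-distribˡ-+ c (f x) _ ⟨
  c * (f x + sumℚ (map f xs))             ∎
  where open ≡-Reasoning

p≤1⇒0≤1-p : ∀ {p} → p ≤ 1ℚ → 0ℚ ≤ 1ℚ - p
p≤1⇒0≤1-p {p} p≤1 = subst (_≤ 1ℚ - p) (+-inverseʳ p) (+-monoˡ-≤ (- p) p≤1)

0≤p⇒1-p≤1 : ∀ {p} → 0ℚ ≤ p → 1ℚ - p ≤ 1ℚ
0≤p⇒1-p≤1 {p} 0≤p = subst (1ℚ - p ≤_) (+-identityʳ 1ℚ) (+-monoʳ-≤ 1ℚ (neg-antimono-≤ 0≤p))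

^ℚ-nonNeg : ∀ {q} n → 0ℚ ≤ q → 0ℚ ≤ q ^ℚ n
^ℚ-nonNeg     zero    0≤q = nonNegative⁻¹ 1ℚ
^ℚ-nonNeg {q} (suc n) 0≤q = subst (_≤ q * q ^ℚ n) (*-zeroʳ q)
  (*-monoˡ-≤-nonNeg q {{nonNegative 0≤q}} (^ℚ-nonNeg n 0≤q))

^ℚ-≤1 : ∀ {q} n → 0ℚ ≤ q → q ≤ 1ℚ → q ^ℚ n ≤ 1ℚ
^ℚ-≤1     zero    0≤q q≤1 = ≤-refl
^ℚ-≤1 {q} (suc n) 0≤q q≤1 = ≤-trans
  (subst (q * q ^ℚ n ≤_) (*-identityʳ q) (*-monoˡ-≤-nonNeg q {{nonNegative 0≤q}} (^ℚ-≤1 n 0≤q q≤1)))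
  q≤1

^ℚ-antimonoʳ-≤ : ∀ {q m n} → 0ℚ ≤ q → q ≤ 1ℚ → m ℕ.≤ n → q ^ℚ n ≤ q ^ℚ m
^ℚ-antimonoʳ-≤ {n = n} 0≤q q≤1 ℕ.z≤n       = ^ℚ-≤1 n 0≤q q≤1
^ℚ-antimonoʳ-≤ {q}     0≤q q≤1 (ℕ.s≤s m≤n) =
  *-monoˡ-≤-nonNeg q {{nonNegative 0≤q}} (^ℚ-antimonoʳ-≤ 0≤q q≤1 m≤n)

minList-≤ : ∀ {k ns} → k ∈ ns → minList ns ℕ.≤ k
minList-≤ {k} {n ∷ ns} k∈n∷ns = foldr-preservesᵒ ⊓-≤ n ns (head-or-tail k∈n∷ns)
  where
  ⊓-≤ : ∀ a b → a ℕ.≤ k ⊎ b ℕ.≤ k → a ℕ.⊓ b ℕ.≤ k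
  ⊓-≤ a b = [ ℕ.m≤n⇒m⊓o≤n b , ℕ.m≤n⇒o⊓m≤n a ]
  head-or-tail : k ∈ n ∷ ns → n ℕ.≤ k ⊎ Any (ℕ._≤ k) ns
  head-or-tail (here k≡n)   = inj₁ (ℕ.≤-reflexive (sym k≡n))
  head-or-tail (there k∈ns) = inj₂ (Any.map (ℕ.≤-reflexive ∘ sym) k∈ns)

filter-map : ∀ {A B : Set} {P : B → Set} (P? : ∀ y → Dec (P y)) (f : A → B) (xs : List A) →
             filter P? (map f xs) ≡ map f (filter (P? ∘ f) xs)
filter-map P? f []       = refl
filter-map P? f (x ∷ xs) with does (P? (f x))
... | true  = cong (f x ∷_) (filter-map P? f xs)
... | false = filter-map P? f xs

count : ∀ {n} → (Fin n → Bool) → ℕ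
count s = length (filter (T? ∘ s) (allFin _))

count-tail : ∀ {n} (s : Fin (suc n) → Bool) →
             length (filter (T? ∘ s) (tabulate suc)) ≡ count (s ∘ suc)
count-tail {n} s = begin
  length (filter (T? ∘ s) (tabulate suc))
    ≡⟨ cong (length ∘ filter (T? ∘ s)) (map-tabulate id suc) ⟨
  length (filter (T? ∘ s) (map suc (allFin n)))
    ≡⟨ cong length (filter-map (T? ∘ s) suc (allFin n)) ⟩
  length (map suc (filter (T? ∘ s ∘ suc) (allFin n)))
    ≡⟨ length-map Fin.suc (filter (T? ∘ s ∘ suc) (allFin n)) ⟩
  count (s ∘ suc)
    ∎
  where open ≡-Reasoning

count-accept : ∀ {n} (s : Fin (suc n) → Bool) → T (s zero) → count s ≡ suc (count (s ∘ suc))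
count-accept s s₀ = trans (cong length (filter-accept (T? ∘ s) s₀)) (cong suc (count-tail s))

count-reject : ∀ {n} (s : Fin (suc n) → Bool) → ¬ T (s zero) → count s ≡ count (s ∘ suc)
count-reject s ¬s₀ = trans (cong length (filter-reject (T? ∘ s) ¬s₀)) (count-tail s)

𝟙 : Bool → ℚ
𝟙 b = if b then 1ℚ else 0ℚ

𝟙≤1 : ∀ b → 𝟙 b ≤ 1ℚ
𝟙≤1 true  = ≤-refl
𝟙≤1 false = nonNegative⁻¹ 1ℚ

𝟙≤0 : ∀ {b} → ¬ T b → 𝟙 b ≤ 0ℚ
𝟙≤0 {false} _  = ≤-refl
𝟙≤0 {true}  ¬t = ⊥-elim (¬t tt)

𝔼 : ℚ → (n : ℕ) → (Vec Bool n → ℚ) → ℚ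
𝔼 p n f = sumℚ (map (λ v → weight p v * f v) (allSubsets n))

module _ (p : ℚ) where

  𝔼-[] : (f : Vec Bool 0 → ℚ) → 𝔼 p 0 f ≡ f []
  𝔼-[] f = solve 1 (λ a → con 1ℚ :* a :+ con 0ℚ := a) refl (f [])

  𝔼-∷ : ∀ n (f : Vec Bool (suc n) → ℚ) →
        𝔼 p (suc n) f ≡ p * 𝔼 p n (f ∘ (true ∷_)) + (1ℚ - p) * 𝔼 p n (f ∘ (false ∷_))
  𝔼-∷ n f = split-heads (allSubsets n)
    where
    term : Bool → Vec Bool n → ℚ
    term b v = weight p v * f (b ∷ v)
    split-heads : ∀ vs →
      sumℚ (map (λ v → weight p v * f v) (concatMap (λ v → (true ∷ v) ∷ (false ∷ v) ∷ []) vs))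
      ≡ p * sumℚ (map (term true) vs) + (1ℚ - p) * sumℚ (map (term false) vs)
    split-heads []       = solve 1 (λ p → con 0ℚ := p :* con 0ℚ :+ (con 1ℚ :- p) :* con 0ℚ) refl p
    split-heads (v ∷ vs) =
      trans (cong (λ r → p * weight p v * f (true ∷ v) + ((1ℚ - p) * weight p v * f (false ∷ v) + r))
                  (split-heads vs))
            (solve 6 (λ p w a b s t → p :* w :* a :+ ((con 1ℚ :- p) :* w :* b :+ (p :* s :+ (con 1ℚ :- p) :* t))
                                   := p :* (w :* a :+ s) :+ (con 1ℚ :- p) :* (w :* b :+ t))
                     refl p (weight p v) (f (true ∷ v)) (f (false ∷ v))
                     (sumℚ (map (term true) vs)) (sumℚ (map (term false) vs)))

  𝔼-const : ∀ n (c : ℚ) → 𝔼 p n (λ _ → c) ≡ c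
  𝔼-const zero    c = 𝔼-[] (λ _ → c)
  𝔼-const (suc n) c = begin
    𝔼 p (suc n) (λ _ → c)
      ≡⟨ 𝔼-∷ n (λ _ → c) ⟩
    p * 𝔼 p n (λ _ → c) + (1ℚ - p) * 𝔼 p n (λ _ → c)
      ≡⟨ cong₂ (λ a b → p * a + (1ℚ - p) * b) (𝔼-const n c) (𝔼-const n c) ⟩
    p * c + (1ℚ - p) * c
      ≡⟨ solve 2 (λ p c → p :* c :+ (con 1ℚ :- p) :* c := c) refl p c ⟩
    c ∎
    where open ≡-Reasoning

  𝔼-+ : ∀ n (f g : Vec Bool n → ℚ) → 𝔼 p n (λ v → f v + g v) ≡ 𝔼 p n f + 𝔼 p n g
  𝔼-+ zero    f g = trans (𝔼-[] (λ v → f v + g v)) (sym (cong₂ _+_ (𝔼-[] f) (𝔼-[] g)))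
  𝔼-+ (suc n) f g = begin
    𝔼 p (suc n) (λ v → f v + g v)
      ≡⟨ 𝔼-∷ n (λ v → f v + g v) ⟩
    p * 𝔼 p n (λ v → f (true ∷ v) + g (true ∷ v)) + (1ℚ - p) * 𝔼 p n (λ v → f (false ∷ v) + g (false ∷ v))
      ≡⟨ cong₂ (λ a b → p * a + (1ℚ - p) * b) (𝔼-+ n _ _) (𝔼-+ n _ _) ⟩
    p * (ft + gt) + (1ℚ - p) * (ff + gf)
      ≡⟨ solve 5 (λ p a b c d → p :* (a :+ b) :+ (con 1ℚ :- p) :* (c :+ d)
                             := (p :* a :+ (con 1ℚ :- p) :* c) :+ (p :* b :+ (con 1ℚ :- p) :* d))
                 refl p ft gt ff gf ⟩
    (p * ft + (1ℚ - p) * ff) + (p * gt + (1ℚ - p) * gf)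
      ≡⟨ cong₂ _+_ (𝔼-∷ n f) (𝔼-∷ n g) ⟨
    𝔼 p (suc n) f + 𝔼 p (suc n) g ∎
    where
    open ≡-Reasoning
    ft ff gt gf : ℚ
    ft = 𝔼 p n (f ∘ (true ∷_))
    ff = 𝔼 p n (f ∘ (false ∷_))
    gt = 𝔼 p n (g ∘ (true ∷_))
    gf = 𝔼 p n (g ∘ (false ∷_))

Hits : ∀ {n} → (Fin n → Bool) → Vec Bool n → Set
Hits s v = ∃ λ i → T (lookup v i) × T (s i)

-- The test on v comes first so that  does (hits? s (b ∷ v))  computes to  b ∧ s zero ∨ …,
-- which is false or  s zero ∨ …  as soon as b is known.
hits? : ∀ {n} (s : Fin n → Bool) (v : Vec Bool n) → Dec (Hits s v)
hits? s v = any? (λ i → T? (lookup v i) ×-dec T? (s i))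

misses : ∀ {n} → (Fin n → Bool) → Vec Bool n → Bool
misses s v = not (does (hits? s v))

𝔼-𝟙-misses : ∀ p n (s : Fin n → Bool) → 𝔼 p n (𝟙 ∘ misses s) ≡ (1ℚ - p) ^ℚ count s
𝔼-𝟙-misses p zero    s = 𝔼-[] p (𝟙 ∘ misses s)
𝔼-𝟙-misses p (suc n) s = trans (𝔼-∷ p n (𝟙 ∘ misses s)) (by-head (s zero) refl)
  where
  open ≡-Reasoning
  q : ℚ
  q = 1ℚ - p
  misses-tail : ℚ
  misses-tail = 𝔼 p n (𝟙 ∘ misses (s ∘ suc))
  by-head : ∀ b → s zero ≡ b →
            p * 𝔼 p n (λ v → 𝟙 (not (b ∨ does (hits? (s ∘ suc) v)))) + q * misses-tail ≡ q ^ℚ count s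
  by-head true s₀ = begin
    p * 𝔼 p n (λ _ → 0ℚ) + q * misses-tail
      ≡⟨ cong₂ (λ a b → p * a + q * b) (𝔼-const p n 0ℚ) (𝔼-𝟙-misses p n (s ∘ suc)) ⟩
    p * 0ℚ + q * q ^ℚ count (s ∘ suc)
      ≡⟨ solve 2 (λ p r → p :* con 0ℚ :+ r := r) refl p (q * q ^ℚ count (s ∘ suc)) ⟩
    q ^ℚ suc (count (s ∘ suc))
      ≡⟨ cong (q ^ℚ_) (count-accept s (subst T (sym s₀) tt)) ⟨
    q ^ℚ count s ∎
  by-head false s₀ = begin
    p * misses-tail + q * misses-tail
      ≡⟨ solve 2 (λ p m → p :* m :+ (con 1ℚ :- p) :* m := m) refl p misses-tail ⟩
    misses-tail
      ≡⟨ 𝔼-𝟙-misses p n (s ∘ suc) ⟩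
    q ^ℚ count (s ∘ suc)
      ≡⟨ cong (q ^ℚ_) (count-reject s (subst T s₀)) ⟨
    q ^ℚ count s ∎

module _ {p : ℚ} (0≤p : 0ℚ ≤ p) (p≤1 : p ≤ 1ℚ) where

  𝔼-mono : ∀ n {f g : Vec Bool n → ℚ} → (∀ v → f v ≤ g v) → 𝔼 p n f ≤ 𝔼 p n g
  𝔼-mono zero    {f} {g} f≤g = subst₂ _≤_ (sym (𝔼-[] p f)) (sym (𝔼-[] p g)) (f≤g [])
  𝔼-mono (suc n) {f} {g} f≤g = subst₂ _≤_ (sym (𝔼-∷ p n f)) (sym (𝔼-∷ p n g)) (+-mono-≤
    (*-monoˡ-≤-nonNeg p {{nonNegative 0≤p}} (𝔼-mono n (f≤g ∘ (true ∷_))))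
    (*-monoˡ-≤-nonNeg (1ℚ - p) {{nonNegative (p≤1⇒0≤1-p p≤1)}} (𝔼-mono n (f≤g ∘ (false ∷_)))))

  𝔼-≤-const : ∀ n {f : Vec Bool n → ℚ} {c} → (∀ v → f v ≤ c) → 𝔼 p n f ≤ c
  𝔼-≤-const n {c = c} f≤c = subst (_ ≤_) (𝔼-const p n c) (𝔼-mono n f≤c)

  𝔼≤[1-p]^m+c : ∀ n (s : Fin n → Bool) {m} {f : Vec Bool n → ℚ} {c} → m ℕ.≤ count s → 0ℚ ≤ c →
                (∀ v → f v ≤ 1ℚ) → (∀ v → Hits s v → f v ≤ c) → 𝔼 p n f ≤ (1ℚ - p) ^ℚ m + c
  𝔼≤[1-p]^m+c n s {m} {f} {c} m≤|s| 0≤c f≤1 hit⇒f≤c = begin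
    𝔼 p n f
      ≤⟨ 𝔼-mono n f≤𝟙[misses]+c ⟩
    𝔼 p n (λ v → 𝟙 (misses s v) + c)
      ≡⟨ 𝔼-+ p n (𝟙 ∘ misses s) (λ _ → c) ⟩
    𝔼 p n (𝟙 ∘ misses s) + 𝔼 p n (λ _ → c)
      ≡⟨ cong₂ _+_ (𝔼-𝟙-misses p n s) (𝔼-const p n c) ⟩
    (1ℚ - p) ^ℚ count s + c
      ≤⟨ +-monoˡ-≤ c (^ℚ-antimonoʳ-≤ (p≤1⇒0≤1-p p≤1) (0≤p⇒1-p≤1 0≤p) m≤|s|) ⟩
    (1ℚ - p) ^ℚ m + c ∎
    where
    open ≤-Reasoning
    f≤𝟙[misses]+c : ∀ v → f v ≤ 𝟙 (misses s v) + c
    f≤𝟙[misses]+c v with hits? s v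
    ... | yes hit = subst (f v ≤_) (sym (+-identityˡ c)) (hit⇒f≤c v hit)
    ... | no _    = ≤-trans (f≤1 v) (subst (_≤ 1ℚ + c) (+-identityʳ 1ℚ) (+-monoʳ-≤ 1ℚ 0≤c))

module _ {nx ny nz : ℕ} (R : Rel3 nx ny nz) where

  inπX : Fin nx → Bool
  inπX x = any (λ y → any (R x y) (allFin nz)) (allFin ny)

  inπXY : Fin nx → Fin ny → Bool
  inπXY x y = any (R x y) (allFin nz)

  ∈-projX : ∀ {x} → T (inπX x) → x ∈ projX R
  ∈-projX {x} = ∈-filter⁺ (T? ∘ inπX) (∈-allFin x)

  ∈-projXY : ∀ {x y} → T (inπXY x y) → (x , y) ∈ projXY R
  ∈-projXY {x} {y} = ∈-filter⁺ (λ (a , b) → T? (inπXY a b))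
    (∈-concatMap⁺ _ (lose (∈-allFin x) (∈-map⁺ (x ,_) (∈-allFin y))))

  ¬T-disjointBox : ∀ A B C {x y z} → T (R x y z) → T (lookup A x) → T (lookup B y) → T (lookup C z) →
                   ¬ T (disjointBox R A B C)
  ¬T-disjointBox A B C {x} {y} {z} Rxyz Ax By Cz disjoint =
    not-both (∧-intro Rxyz (∧-intro Ax (∧-intro By Cz))) (at z (at y (at x disjoint)))
    where
    at : ∀ {m} {f : Fin m → Bool} i → T (all f (allFin m)) → T (f i)
    at i t = All.lookup (all⁺ _ _ t) (∈-allFin i)
    ∧-intro : ∀ {a b} → T a → T b → T (a ∧ b)
    ∧-intro ta tb = Equivalence.from T-∧ (ta , tb)
    not-both : ∀ {b} → T b → ¬ T (if b then false else true)
    not-both {true} _ ()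

  probDisjoint≡iterated-𝔼 : ∀ α β γ →
    probDisjoint R α β γ ≡ 𝔼 α nx (λ A → 𝔼 β ny (λ B → 𝔼 γ nz (λ C → 𝟙 (disjointBox R A B C))))
  probDisjoint≡iterated-𝔼 α β γ = cong sumℚ (map-cong sum-over-B (allSubsets nx))
    where
    summand : Vec Bool nx → Vec Bool ny → Vec Bool nz → ℚ
    summand A B C = if disjointBox R A B C then weight α A * weight β B * weight γ C else 0ℚ
    summand≡ : ∀ A B C →
               summand A B C ≡ weight α A * (weight β B * (weight γ C * 𝟙 (disjointBox R A B C)))
    summand≡ A B C with disjointBox R A B C
    ... | true  = solve 3 (λ a b c → a :* b :* c := a :* (b :* (c :* con 1ℚ))) refl
                          (weight α A) (weight β B) (weight γ C)
    ... | false = solve 3 (λ a b c → con 0ℚ := a :* (b :* (c :* con 0ℚ))) refl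
                          (weight α A) (weight β B) (weight γ C)
    sum-over-C : ∀ A B → sumℚ (map (summand A B) (allSubsets nz))
                         ≡ weight α A * (weight β B * 𝔼 γ nz (λ C → 𝟙 (disjointBox R A B C)))
    sum-over-C A B = trans (cong sumℚ (map-cong (summand≡ A B) (allSubsets nz)))
      (trans (sumℚ-map-*ˡ (weight α A) _ (allSubsets nz))
             (cong (weight α A *_) (sumℚ-map-*ˡ (weight β B) _ (allSubsets nz))))
    sum-over-B : ∀ A → sumℚ (map (λ B → sumℚ (map (summand A B) (allSubsets nz))) (allSubsets ny))
                       ≡ weight α A * 𝔼 β ny (λ B → 𝔼 γ nz (λ C → 𝟙 (disjointBox R A B C)))
    sum-over-B A = trans (cong sumℚ (map-cong (sum-over-C A) (allSubsets ny)))
                         (sumℚ-map-*ˡ (weight α A) _ (allSubsets ny))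

  minFibreY minFibreZ : ℕ
  minFibreY = minList (map (fibreYsize R) (projX R))
  minFibreZ = minList (map (λ p → fibreZsize R (proj₁ p) (proj₂ p)) (projXY R))

  module _ {α β γ : ℚ} (0≤α : 0ℚ ≤ α) (α≤1 : α ≤ 1ℚ) (0≤β : 0ℚ ≤ β) (β≤1 : β ≤ 1ℚ)
           (0≤γ : 0ℚ ≤ γ) (γ≤1 : γ ≤ 1ℚ) where

    𝔼[C]≤ : ∀ A B {x y} → T (lookup A x) → T (lookup B y) → T (inπXY x y) →
            𝔼 γ nz (λ C → 𝟙 (disjointBox R A B C)) ≤ (1ℚ - γ) ^ℚ minFibreZ
    𝔼[C]≤ A B {x} {y} Ax By xy∈πXY =
      subst (𝔼 γ nz (λ C → 𝟙 (disjointBox R A B C)) ≤_) (+-identityʳ _)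
        (𝔼≤[1-p]^m+c 0≤γ γ≤1 nz (R x y) (minList-≤ (∈-map⁺ _ (∈-projXY xy∈πXY))) ≤-refl
          (λ C → 𝟙≤1 (disjointBox R A B C))
          (λ C (z , Cz , Rxyz) → 𝟙≤0 (¬T-disjointBox A B C Rxyz Ax By Cz)))

    𝔼[BC]≤ : ∀ A {x} → T (lookup A x) → T (inπX x) →
             𝔼 β ny (λ B → 𝔼 γ nz (λ C → 𝟙 (disjointBox R A B C)))
               ≤ (1ℚ - β) ^ℚ minFibreY + (1ℚ - γ) ^ℚ minFibreZ
    𝔼[BC]≤ A {x} Ax x∈πX =
      𝔼≤[1-p]^m+c 0≤β β≤1 ny (inπXY x) (minList-≤ (∈-map⁺ (fibreYsize R) (∈-projX x∈πX)))
        (^ℚ-nonNeg minFibreZ (p≤1⇒0≤1-p γ≤1))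
        (λ B → 𝔼-≤-const 0≤γ γ≤1 nz (λ C → 𝟙≤1 (disjointBox R A B C)))
        (λ B (y , By , xy∈πXY) → 𝔼[C]≤ A B Ax By xy∈πXY)

    𝔼[ABC]≤ : 𝔼 α nx (λ A → 𝔼 β ny (λ B → 𝔼 γ nz (λ C → 𝟙 (disjointBox R A B C))))
              ≤ (1ℚ - α) ^ℚ length (projX R) + ((1ℚ - β) ^ℚ minFibreY + (1ℚ - γ) ^ℚ minFibreZ)
    𝔼[ABC]≤ =
      𝔼≤[1-p]^m+c 0≤α α≤1 nx inπX ℕ.≤-refl
        (+-mono-≤ (^ℚ-nonNeg minFibreY (p≤1⇒0≤1-p β≤1)) (^ℚ-nonNeg minFibreZ (p≤1⇒0≤1-p γ≤1)))
        (λ A → 𝔼-≤-const 0≤β β≤1 ny (λ B → 𝔼-≤-const 0≤γ γ≤1 nz (λ C → 𝟙≤1 (disjointBox R A B C))))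
        (λ A (x , Ax , x∈πX) → 𝔼[BC]≤ A Ax x∈πX)

lemma4p5 : (nx ny nz : ℕ) (T : Rel3 nx ny nz) (α β γ : ℚ) →
           0ℚ ≤ α → α ≤ 1ℚ → 0ℚ ≤ β → β ≤ 1ℚ → 0ℚ ≤ γ → γ ≤ 1ℚ →
           probDisjoint T α β γ ≤
             ((1ℚ - α) ^ℚ length (projX T))
             + ((1ℚ - β) ^ℚ minList (map (fibreYsize T) (projX T)))
             + ((1ℚ - γ) ^ℚ minList (map (λ p → fibreZsize T (proj₁ p) (proj₂ p)) (projXY T)))
lemma4p5 nx ny nz R α β γ 0≤α α≤1 0≤β β≤1 0≤γ γ≤1 = begin
  probDisjoint R α β γ
    ≡⟨ probDisjoint≡iterated-𝔼 R α β γ ⟩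
  𝔼 α nx (λ A → 𝔼 β ny (λ B → 𝔼 γ nz (λ C → 𝟙 (disjointBox R A B C))))
    ≤⟨ 𝔼[ABC]≤ R 0≤α α≤1 0≤β β≤1 0≤γ γ≤1 ⟩
  cX + (cY + cZ)
    ≡⟨ +-assoc cX cY cZ ⟨
  cX + cY + cZ ∎
  where
  open ≤-Reasoning
  cX cY cZ : ℚ
  cX = (1ℚ - α) ^ℚ length (projX R)
  cY = (1ℚ - β) ^ℚ minFibreY R
  cZ = (1ℚ - γ) ^ℚ minFibreZ R
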